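{- Let $q\ge0$ and let $D\subseteq E(\triangle_q)$. If $D$ is not a $\sigma$-$\tau$ edge cut, then there is a $\sigma$-$\tau$ path of length at most $|D|+1$ in $\triangle_q-D$.
   Context: The $q$-triangle fractal $\triangle_q$ is built as follows: start with two vertices $\sigma,\tau$ joined by one edge, which is marked. Then repeat $q$ times: for every currently marked edge $\{a,b\}$ add a new vertex $w$ and the two new edges $\{a,w\},\{w,b\}$, mark these new edges, and unmark all previously marked edges. A $\sigma$-$\tau$ edge cut is an edge set whose removal disconnects $\sigma$ from $\tau$. Path length is the number of edges. -}

module Defs where

open import Data.Bool using (Bool; true; false)
open import Data.Nat using (ℕ; zero; suc; _≤_; _+_)
open import Data.List using (List; []; _∷_; _∷ʳ_; length)
open import Data.List.Membership.Propositional using (_∈_)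
open import Data.List.Relation.Unary.All using (All)
open import Data.List.Relation.Unary.Unique.Propositional using (Unique)
open import Data.Product using (_×_; _,_; ∃; Σ)
open import Data.Sum using (_⊎_)
open import Relation.Nullary using (¬_)
open import Relation.Binary.PropositionalEquality using (_≡_)
open import Relation.Binary.Construct.Closure.ReflexiveTransitive using (Star; ε; _◅_)

-- Vertices of the q-triangle fractal.
-- σ and τ are the two initial vertices; `mid s` is the vertex added when
-- subdividing the edge labelled by the binary word s (it exists in △_q
-- exactly when length s < q).
data Vertex : Set where
  σ   : Vertex
  τ   : Vertex
  mid : List Bool → Vertex

-- Edges are labelled by binary words s (root first): [] is the original
-- σ-τ edge; subdividing edge s (endpoints a,b, new vertex mid s) produces
-- edge s ∷ʳ false = {a, mid s} and edge s ∷ʳ true = {mid s, b}.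
-- The edges of △_q are exactly the words of length ≤ q.
-- `ends pre s a b` : endpoints of edge pre ++ s, given that edge pre has
-- endpoints a , b.
ends : List Bool → List Bool → Vertex → Vertex → Vertex × Vertex
ends pre []          a b = a , b
ends pre (false ∷ s) a b = ends (pre ∷ʳ false) s a (mid pre)
ends pre (true  ∷ s) a b = ends (pre ∷ʳ true)  s (mid pre) b

endpoints : List Bool → Vertex × Vertex
endpoints s = ends [] s σ τ

IsEdge : ℕ → List Bool → Set
IsEdge q s = length s ≤ q

Adj : ℕ → List (List Bool) → Vertex → Vertex → Set
Adj q D u v = ∃ λ s → IsEdge q s × ¬ (s ∈ D) ×
                ((endpoints s ≡ (u , v)) ⊎ (endpoints s ≡ (v , u)))

Walk : ℕ → List (List Bool) → Vertex → Vertex → Set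
Walk q D = Star (Adj q D)

walkLength : ∀ {q D u v} → Walk q D u v → ℕ
walkLength ε       = 0
walkLength (_ ◅ w) = suc (walkLength w)

walkVertices : ∀ {q D u v} → Walk q D u v → List Vertex
walkVertices {v = v} ε = v ∷ []
walkVertices {u = u} (_ ◅ w) = u ∷ walkVertices w

IsPath : ∀ {q D u v} → Walk q D u v → Set
IsPath w = Unique (walkVertices w)

IsEdgeCut : ℕ → List (List Bool) → Set
IsEdgeCut q D = ¬ Walk q D σ τ

module Submission where

-- Call an edge s of the fractal "bridged" at depth k if its
-- endpoints are joined inside the part of △_q − D that subdivides s in k
-- further rounds: either s ∉ D, or s ∈ D, k > 0 and both children s∷ʳfalse,
-- s∷ʳtrue are bridged at depth k − 1.  Otherwise s is "severed".  Every edge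
-- is decidably one or the other, and we apply this to the root edge [] at
-- depth q.
--
--  * Bridged: recursion on the derivation builds a σ-τ walk whose length is
--    at most 1 + (number of D-edges below the root), because every split
--    consumes the D-edge being split and the two children count disjoint
--    parts of D.  Loop erasure turns it into a path that is no longer.
--  * Severed: the severing derivation determines a 2-colouring Φ of the
--    vertices with Φ σ = false, Φ τ = true, such that every edge outside D
--    has equally coloured endpoints; so no walk joins σ to τ, i.e. D is a cut.

open import Defs
open import Data.Bool using (Bool; true; false)
import Data.Bool.Properties as Bool
open import Data.Nat using (ℕ; zero; suc; _≤_; _+_; z≤n; s≤s)
open import Data.Nat.Properties
  using (≤-refl; ≤-trans; +-suc; +-comm; +-assoc; +-mono-≤; n≤1+n; m≤n⇒m≤1+n; m≤m+n; +-commutativeSemigroup; module ≤-Reasoning)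
open import Algebra.Properties.CommutativeSemigroup +-commutativeSemigroup using (interchange)
open import Data.List using (List; []; _∷_; _∷ʳ_; _++_; [_]; length; map)
open import Data.Nat.ListAction using (sum)
open import Data.List.Properties using (++-assoc; ++-identityʳ; length-++; ≡-dec)
open import Data.List.Membership.Propositional using (_∈_)
open import Data.List.Relation.Unary.Any using (here; there)
open import Data.List.Relation.Unary.All using (All; [])
open import Data.List.Relation.Unary.All.Properties.Core using (¬Any⇒All¬)
open import Data.List.Relation.Unary.Unique.Propositional using (Unique)
open import Data.List.Relation.Unary.AllPairs using ([]; _∷_)
open import Data.Product using (Σ; _×_; _,_; proj₁; proj₂; uncurry)
open import Data.Sum using (_⊎_; inj₁; inj₂)
open import Data.Empty using (⊥-elim)
open import Function using (_∘_)
open import Relation.Nullary using (¬_; yes; no)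
open import Relation.Nullary.Decidable using (map′)
open import Relation.Binary.PropositionalEquality
  using (_≡_; refl; sym; trans; cong; subst)
open import Relation.Binary.Definitions using (DecidableEquality)
open import Relation.Binary.Construct.Closure.ReflexiveTransitive using (ε; _◅_; _◅◅_)

_≟ₗ_ : DecidableEquality (List Bool)
_≟ₗ_ = ≡-dec Bool._≟_

open import Data.List.Membership.DecPropositional _≟ₗ_ using (_∈?_)

subdivide : Bool → List Bool → Vertex × Vertex → Vertex × Vertex
subdivide false pre (a , b) = a , mid pre
subdivide true  pre (a , b) = mid pre , b

ends-∷ʳ : ∀ pre s x a b → ends pre (s ∷ʳ x) a b ≡ subdivide x (pre ++ s) (ends pre s a b)
ends-∷ʳ pre [] false a b = cong (λ r → a , mid r) (sym (++-identityʳ pre))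
ends-∷ʳ pre [] true  a b = cong (λ r → mid r , b) (sym (++-identityʳ pre))
ends-∷ʳ pre (false ∷ s) x a b =
  trans (ends-∷ʳ (pre ∷ʳ false) s x a (mid pre))
        (cong (λ r → subdivide x r (ends (pre ∷ʳ false) s a (mid pre))) (++-assoc pre [ false ] s))
ends-∷ʳ pre (true ∷ s) x a b =
  trans (ends-∷ʳ (pre ∷ʳ true) s x (mid pre) b)
        (cong (λ r → subdivide x r (ends (pre ∷ʳ true) s (mid pre) b)) (++-assoc pre [ true ] s))

endpoints-child : ∀ pre x {a b} → endpoints pre ≡ (a , b) →
                  endpoints (pre ∷ʳ x) ≡ subdivide x pre (a , b)
endpoints-child pre x e = trans (ends-∷ʳ [] pre x σ τ) (cong (subdivide x pre) e)

-- Boolean prefix test: p ≼ d holds when edge d lies in the subdivision of p.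
_≼_ : List Bool → List Bool → Bool
[]          ≼ d           = true
(x ∷ p)     ≼ []          = false
(false ∷ p) ≼ (false ∷ d) = p ≼ d
(true ∷ p)  ≼ (true ∷ d)  = p ≼ d
(false ∷ p) ≼ (true ∷ d)  = false
(true ∷ p)  ≼ (false ∷ d) = false

indicator : Bool → ℕ
indicator true  = 1
indicator false = 0

indicator≤1 : ∀ b → indicator b ≤ 1
indicator≤1 true  = s≤s z≤n
indicator≤1 false = z≤n

children-disjoint : ∀ p d → indicator ((p ∷ʳ false) ≼ d) + indicator ((p ∷ʳ true) ≼ d) ≤ indicator (p ≼ d)
children-disjoint [] []                = z≤n
children-disjoint [] (false ∷ d)       = ≤-refl
children-disjoint [] (true ∷ d)        = ≤-refl
children-disjoint (x ∷ p) []           = z≤n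
children-disjoint (false ∷ p) (false ∷ d) = children-disjoint p d
children-disjoint (true ∷ p) (true ∷ d)   = children-disjoint p d
children-disjoint (false ∷ p) (true ∷ d)  = z≤n
children-disjoint (true ∷ p) (false ∷ d)  = z≤n

≼-refl : ∀ p → p ≼ p ≡ true
≼-refl []          = refl
≼-refl (false ∷ p) = ≼-refl p
≼-refl (true ∷ p)  = ≼-refl p

∷ʳ-⋠ : ∀ p x → (p ∷ʳ x) ≼ p ≡ false
∷ʳ-⋠ []          x = refl
∷ʳ-⋠ (false ∷ p) x = ∷ʳ-⋠ p x
∷ʳ-⋠ (true ∷ p)  x = ∷ʳ-⋠ p x

sum-split : ∀ {A : Set} (f g h : A → ℕ) → (∀ x → f x + g x ≤ h x) →
            ∀ xs → sum (map f xs) + sum (map g xs) ≤ sum (map h xs)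
sum-split f g h le []       = z≤n
sum-split f g h le (x ∷ xs) =
  subst (_≤ sum (map h (x ∷ xs))) (interchange (f x) (g x) (sum (map f xs)) (sum (map g xs)))
        (+-mono-≤ (le x) (sum-split f g h le xs))

sum-split-strict : ∀ {A : Set} (f g h : A → ℕ) → (∀ x → f x + g x ≤ h x) →
                   ∀ {y} xs → y ∈ xs → suc (f y + g y) ≤ h y →
                   suc (sum (map f xs) + sum (map g xs)) ≤ sum (map h xs)
sum-split-strict f g h le (x ∷ xs) (here refl) lt =
  subst (_≤ sum (map h (x ∷ xs))) (cong suc (interchange (f x) (g x) (sum (map f xs)) (sum (map g xs))))
        (+-mono-≤ lt (sum-split f g h le xs))
sum-split-strict f g h le (x ∷ xs) (there y∈) lt =
  subst (_≤ sum (map h (x ∷ xs)))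
        (trans (+-suc (f x + g x) _) (cong suc (interchange (f x) (g x) (sum (map f xs)) (sum (map g xs)))))
        (+-mono-≤ (le x) (sum-split-strict f g h le xs y∈ lt))

below : List Bool → List (List Bool) → ℕ
below p D = sum (map (λ d → indicator (p ≼ d)) D)

below≤length : ∀ p D → below p D ≤ length D
below≤length p []      = z≤n
below≤length p (d ∷ D) = +-mono-≤ (indicator≤1 (p ≼ d)) (below≤length p D)

-- Splitting a D-edge: the edge itself plus its two children's counts.
below-split : ∀ p D → p ∈ D → suc (below (p ∷ʳ false) D + below (p ∷ʳ true) D) ≤ below p D
below-split p D p∈D = sum-split-strict _ _ _ (children-disjoint p) D p∈D strict-at-p
  where
  strict-at-p : suc (indicator ((p ∷ʳ false) ≼ p) + indicator ((p ∷ʳ true) ≼ p)) ≤ indicator (p ≼ p)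
  strict-at-p rewrite ∷ʳ-⋠ p false | ∷ʳ-⋠ p true | ≼-refl p = ≤-refl

walkLength-◅◅ : ∀ {q D u v w} (l : Walk q D u v) (r : Walk q D v w) →
                walkLength (l ◅◅ r) ≡ walkLength l + walkLength r
walkLength-◅◅ ε       r = refl
walkLength-◅◅ (e ◅ l) r = cong suc (walkLength-◅◅ l r)

mid-injective : ∀ {x y} → mid x ≡ mid y → x ≡ y
mid-injective refl = refl

_≟ᵥ_ : DecidableEquality Vertex
σ     ≟ᵥ σ     = yes refl
τ     ≟ᵥ τ     = yes refl
mid x ≟ᵥ mid y = map′ (cong mid) mid-injective (x ≟ₗ y)
σ     ≟ᵥ τ     = no λ ()
σ     ≟ᵥ mid _ = no λ ()
τ     ≟ᵥ σ     = no λ ()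
τ     ≟ᵥ mid _ = no λ ()
mid _ ≟ᵥ σ     = no λ ()
mid _ ≟ᵥ τ     = no λ ()

open import Data.List.Membership.DecPropositional _≟ᵥ_ using () renaming (_∈?_ to _∈ᵥ?_)

path-suffix : ∀ {q D x y u} (p : Walk q D x y) → u ∈ walkVertices p → IsPath p →
              Σ (Walk q D u y) (λ r → IsPath r × walkLength r ≤ walkLength p)
path-suffix ε       (here refl) up       = ε , up , z≤n
path-suffix (e ◅ p) (here refl) up       = e ◅ p , up , ≤-refl
path-suffix (e ◅ p) (there u∈)  (_ ∷ up) with path-suffix p u∈ up
... | r , ur , lr = r , ur , m≤n⇒m≤1+n lr

walk→path : ∀ {q D x y} (w : Walk q D x y) →
            Σ (Walk q D x y) (λ p → IsPath p × walkLength p ≤ walkLength w)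
walk→path ε = ε , [] ∷ [] , z≤n
walk→path {x = x} (e ◅ w) with walk→path w
... | p , up , lp with x ∈ᵥ? walkVertices p
...   | no  x∉ = e ◅ p , ¬Any⇒All¬ _ x∉ ∷ up , s≤s lp
...   | yes x∈ with path-suffix p x∈ up
...     | r , ur , lr = r , ur , ≤-trans lr (≤-trans lp (n≤1+n _))

module _ (D : List (List Bool)) where

  -- The endpoints of edge pre are joined within k more subdivision rounds.
  data Bridged : ℕ → List Bool → Set where
    intact  : ∀ {k pre} → ¬ pre ∈ D → Bridged k pre
    bridged : ∀ {k pre} → pre ∈ D → Bridged k (pre ∷ʳ false) → Bridged k (pre ∷ʳ true) →
              Bridged (suc k) pre

  -- A witness that they are not: a chain of D-edges, each with a severed child.
  data Severed : ℕ → List Bool → Set where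
    severed-leaf  : ∀ {pre} → pre ∈ D → Severed zero pre
    severed-left  : ∀ {k pre} → pre ∈ D → Severed k (pre ∷ʳ false) → Severed (suc k) pre
    severed-right : ∀ {k pre} → pre ∈ D → Severed k (pre ∷ʳ true) → Severed (suc k) pre

  severed-∈ : ∀ {k pre} → Severed k pre → pre ∈ D
  severed-∈ (severed-leaf p∈)    = p∈
  severed-∈ (severed-left p∈ _)  = p∈
  severed-∈ (severed-right p∈ _) = p∈

  bridged-or-severed : ∀ k pre → Bridged k pre ⊎ Severed k pre
  bridged-or-severed k pre with pre ∈? D
  ... | no p∉ = inj₁ (intact p∉)
  bridged-or-severed zero pre    | yes p∈ = inj₂ (severed-leaf p∈)
  bridged-or-severed (suc k) pre | yes p∈
    with bridged-or-severed k (pre ∷ʳ false) | bridged-or-severed k (pre ∷ʳ true)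
  ... | inj₂ sl | _       = inj₂ (severed-left p∈ sl)
  ... | inj₁ _  | inj₂ sr = inj₂ (severed-right p∈ sr)
  ... | inj₁ bl | inj₁ br = inj₁ (bridged p∈ bl br)

child-depth : ∀ {q k} (pre : List Bool) (x : Bool) → length pre + suc k ≤ q → length (pre ∷ʳ x) + k ≤ q
child-depth {q} {k} pre x =
  subst (_≤ q) (sym (trans (cong (_+ k) (length-++ pre {[ x ]})) (+-assoc (length pre) 1 k)))

bridged-walk : ∀ q D {k pre a b} → length pre + k ≤ q → endpoints pre ≡ (a , b) → Bridged D k pre →
               Σ (Walk q D a b) (λ w → walkLength w ≤ suc (below pre D))
bridged-walk q D {k} {pre} depth e (intact p∉) =
  (pre , ≤-trans (m≤m+n _ k) depth , p∉ , inj₁ e) ◅ ε , s≤s z≤n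
bridged-walk q D {suc k} {pre} depth e (bridged p∈ bl br)
  with bridged-walk q D (child-depth pre false depth) (endpoints-child pre false e) bl
     | bridged-walk q D (child-depth pre true depth) (endpoints-child pre true e) br
... | wl , ll | wr , lr = wl ◅◅ wr , length-bound
  where
  open ≤-Reasoning
  length-bound : walkLength (wl ◅◅ wr) ≤ suc (below pre D)
  length-bound = begin
    walkLength (wl ◅◅ wr)                                     ≡⟨ walkLength-◅◅ wl wr ⟩
    walkLength wl + walkLength wr                             ≤⟨ +-mono-≤ ll lr ⟩
    suc (below (pre ∷ʳ false) D) + suc (below (pre ∷ʳ true) D) ≡⟨ cong suc (+-suc _ _) ⟩
    suc (suc (below (pre ∷ʳ false) D + below (pre ∷ʳ true) D)) ≤⟨ s≤s (below-split pre D p∈) ⟩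
    suc (below pre D)                                         ∎

module Separation {q : ℕ} {D : List (List Bool)} (cut : Severed D q []) where

  -- Colour of the vertex mid (pre ++ w) inside a severed edge pre: the side
  -- of the cut it falls on (irrelevant below a leaf, which has no interior).
  side : ∀ {k pre} → Severed D k pre → List Bool → Bool
  side (severed-leaf _)      w           = false
  side (severed-left _ s)    []          = true
  side (severed-left _ s)    (false ∷ w) = side s w
  side (severed-left _ s)    (true ∷ w)  = true
  side (severed-right _ s)   []          = false
  side (severed-right _ s)   (false ∷ w) = false
  side (severed-right _ s)   (true ∷ w)  = side s w

  Φ : Vertex → Bool
  Φ σ       = false
  Φ τ       = true
  Φ (mid w) = side cut w

  Monochrome : Vertex × Vertex → Set
  Monochrome (u , v) = Φ u ≡ Φ v

  data Coloured (k : ℕ) (pre : List Bool) (a b : Vertex) : Set where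
    uniform  : (c : Bool) → Φ a ≡ c → Φ b ≡ c → (∀ w → Φ (mid (pre ++ w)) ≡ c) →
               Coloured k pre a b
    crossing : (s : Severed D k pre) → Φ a ≡ false → Φ b ≡ true →
               (∀ w → Φ (mid (pre ++ w)) ≡ side s w) → Coloured k pre a b

  at-mid : ∀ pre (f : List Bool → Bool) → (∀ w → Φ (mid (pre ++ w)) ≡ f w) → Φ (mid pre) ≡ f []
  at-mid pre f col = trans (cong (Φ ∘ mid) (sym (++-identityʳ pre))) (col [])

  in-child : ∀ pre (f : List Bool → Bool) x → (∀ w → Φ (mid (pre ++ w)) ≡ f w) →
             ∀ w → Φ (mid ((pre ∷ʳ x) ++ w)) ≡ f (x ∷ w)
  in-child pre f x col w = trans (cong (Φ ∘ mid) (++-assoc pre [ x ] w)) (col (x ∷ w))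

  descend : ∀ {k pre a b} x → Coloured (suc k) pre a b →
            Coloured k (pre ∷ʳ x) (proj₁ (subdivide x pre (a , b))) (proj₂ (subdivide x pre (a , b)))
  descend {pre = pre} false (uniform c ca cb col) =
    uniform c ca (at-mid pre (λ _ → c) col) (in-child pre (λ _ → c) false col)
  descend {pre = pre} true  (uniform c ca cb col) =
    uniform c (at-mid pre (λ _ → c) col) cb (in-child pre (λ _ → c) true col)
  descend {pre = pre} false (crossing s@(severed-left _ s′) ca cb col) =
    crossing s′ ca (at-mid pre (side s) col) (in-child pre (side s) false col)
  descend {pre = pre} true  (crossing s@(severed-left _ _) ca cb col) =
    uniform true (at-mid pre (side s) col) cb (in-child pre (side s) true col)
  descend {pre = pre} false (crossing s@(severed-right _ _) ca cb col) =
    uniform false ca (at-mid pre (side s) col) (in-child pre (side s) false col)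
  descend {pre = pre} true  (crossing s@(severed-right _ s′) ca cb col) =
    crossing s′ (at-mid pre (side s) col) cb (in-child pre (side s) true col)

  monochrome : ∀ s {k pre a b} → length s ≤ k → ¬ (pre ++ s ∈ D) → Coloured k pre a b →
               Monochrome (ends pre s a b)
  monochrome [] _ _ (uniform c ca cb _) = trans ca (sym cb)
  monochrome [] {pre = pre} _ ∉D (crossing s _ _ _) =
    ⊥-elim (∉D (subst (_∈ D) (sym (++-identityʳ pre)) (severed-∈ D s)))
  monochrome (x ∷ s) {suc k} {pre} (s≤s len) ∉D col =
    subst Monochrome (ends-cons x) (monochrome s len (∉D ∘ subst (_∈ D) (++-assoc pre [ x ] s)) (descend x col))
    where
    ends-cons : ∀ {a b} x → uncurry (ends (pre ∷ʳ x) s) (subdivide x pre (a , b)) ≡ ends pre (x ∷ s) a b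
    ends-cons false = refl
    ends-cons true  = refl

  root : Coloured q [] σ τ
  root = crossing cut refl refl (λ w → refl)

  adj-monochrome : ∀ {u v} → Adj q D u v → Φ u ≡ Φ v
  adj-monochrome (s , len , ∉D , inj₁ e) = subst Monochrome e (monochrome s len ∉D root)
  adj-monochrome (s , len , ∉D , inj₂ e) = sym (subst Monochrome e (monochrome s len ∉D root))

  walk-monochrome : ∀ {u v} → Walk q D u v → Φ u ≡ Φ v
  walk-monochrome ε       = refl
  walk-monochrome (e ◅ w) = trans (adj-monochrome e) (walk-monochrome w)

  severed-cut : IsEdgeCut q D
  severed-cut w with walk-monochrome w
  ... | ()

lemma9 : (q : ℕ) (D : List (List Bool)) → All (IsEdge q) D → Unique D →
    ¬ IsEdgeCut q D →
    Σ (Walk q D σ τ) (λ p → IsPath p × walkLength p ≤ length D + 1)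
lemma9 q D _ _ not-cut with bridged-or-severed D q []
... | inj₂ cut = ⊥-elim (not-cut (Separation.severed-cut cut))
... | inj₁ br with bridged-walk q D ≤-refl refl br
...   | w , lw with walk→path w
...     | p , p-path , lp = p , p-path , ≤-trans lp (≤-trans lw bound)
  where
  bound : suc (below [] D) ≤ length D + 1
  bound = subst (suc (below [] D) ≤_) (+-comm 1 (length D)) (s≤s (below≤length [] D))
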